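{- Let $S,T\in\operatorname{End}(V\otimes V)$ be of six-vertex form (i.e. $d_1=d_2=0$), and assume that $a_1(S),a_2(S),b_1(S),b_2(S),c_1(S),c_2(S),a_1(T),a_2(T),b_1(T),b_2(T),c_1(T),c_2(T)$ are all nonzero. Then a necessary and sufficient condition for there to exist an $R\in\operatorname{End}(V\otimes V)$ of six-vertex form with $c_1(R)\neq 0$, $c_2(R)\neq 0$ and $\llbracket R,S,T\rrbracket=0$ is that $$\triangle_1(S)=\triangle_1(T)\quad\text{and}\quad \triangle_2(S)=\triangle_2(T).$$
   Context: Let $V$ be a two-dimensional complex vector space with basis $v_+,v_-$. Identify $\operatorname{End}(V\otimes V)$ with $4\times4$ matrices using the ordered basis $v_+\otimes v_+,\ v_+\otimes v_-,\ v_-\otimes v_+,\ v_-\otimes v_-$ (matrices act on column vectors). For a matrix of the form $$R=\begin{pmatrix}a_1&0&0&d_1\\0&b_1&c_1&0\\0&c_2&b_2&0\\d_2&0&0&a_2\end{pmatrix}$$ write $a_1(R)=a_1$, $a_2(R)=a_2$, $b_1(R)=b_1$, etc. $R$ is said to be of six-vertex form if it has this shape with $d_1=d_2=0$. For $\phi\in\operatorname{End}(V\otimes V)$ define $\phi_{12},\phi_{13},\phi_{23}\in\operatorname{End}(V\otimes V\otimes V)$ by requiring, for $\phi=\phi'\otimes\phi''$ with $\phi',\phi''\in\operatorname{End}(V)$, $\phi_{12}=\phi'\otimes\phi''\otimes1$, $\phi_{13}=\phi'\otimes1\otimes\phi''$, $\phi_{23}=1\otimes\phi'\otimes\phi''$,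 and extending linearly. The Yang–Baxter commutator is $\llbracket\phi,\psi,\chi\rrbracket=\phi_{12}\psi_{13}\chi_{23}-\chi_{23}\psi_{13}\phi_{12}$. For $R$ of six-vertex form with $a_1b_1a_2b_2\neq0$ set $$\triangle_1(R)=\frac{a_1a_2+b_1b_2-c_1c_2}{2a_1b_1},\qquad \triangle_2(R)=\frac{a_1a_2+b_1b_2-c_1c_2}{2a_2b_2},$$ where $a_1=a_1(R)$, etc. -}

module Defs where

open import Level using (Level; _⊔_) renaming (suc to lsuc)
open import Algebra.Bundles using (CommutativeRing)
open import Data.Nat using (ℕ; zero) renaming (suc to sucℕ)
open import Data.Fin using (Fin; zero; suc)
open import Data.List using (List; []; _∷_)
open import Data.Product using (∃; _×_; _,_)
open import Relation.Nullary using (¬_)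
open import Data.Empty using (⊥)
open import Data.Unit using (⊤)

module _ {c ℓ} (R : CommutativeRing c ℓ) where
  open CommutativeRing R

  fromℕ : ℕ → Carrier
  fromℕ zero = 0#
  fromℕ (sucℕ n) = 1# + fromℕ n

  -- value at x of the monic polynomial x^n + c_{n-1} x^{n-1} + ... + c_0,
  -- given the coefficient list c_0 ∷ ... ∷ c_{n-1}
  evalMonic : List Carrier → Carrier → Carrier
  evalMonic [] x = 1#
  evalMonic (a ∷ as) x = a + x * evalMonic as x

-- The complex numbers
-- are the model in the paper; by the Lefschetz principle a first-order
-- statement such as the theorem holds over ℂ iff it holds over every such field.
record ACF0 (c ℓ : Level) : Set (lsuc (c ⊔ ℓ)) where
  field
    cring : CommutativeRing c ℓ
  open CommutativeRing cring public
  field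
    _⁻¹     : Carrier → Carrier
    inverse : ∀ x → ¬ (x ≈ 0#) → x * (x ⁻¹) ≈ 1#
    1≉0     : ¬ (1# ≈ 0#)

  field
    char0     : ∀ n → ¬ (fromℕ cring (sucℕ n) ≈ 0#)
    algClosed : ∀ a as → ∃ λ x → evalMonic cring (a ∷ as) x ≈ 0#

module Matrices {c ℓ} (K : ACF0 c ℓ) where
  open ACF0 K public using (Carrier; _≈_; _+_; _*_; _-_; 0#; 1#; _⁻¹)

  _≉0 : Carrier → Set ℓ
  x ≉0 = ¬ (x ≈ 0#)

  _/_ : Carrier → Carrier → Carrier
  x / y = x * (y ⁻¹)

  2# : Carrier
  2# = 1# + 1#

  -- Elements of End(V ⊗ V) as 4×4 matrices w.r.t. the ordered basis
  -- v₊⊗v₊, v₊⊗v₋, v₋⊗v₊, v₋⊗v₋ (indices 0,1,2,3); M i j = entry in row i, column j.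
  Mat4 : Set c
  Mat4 = Fin 4 → Fin 4 → Carrier

  a₁ b₁ c₁ c₂ b₂ a₂ d₁ d₂ : Mat4 → Carrier
  a₁ R = R zero zero
  b₁ R = R (suc zero) (suc zero)
  c₁ R = R (suc zero) (suc (suc zero))
  c₂ R = R (suc (suc zero)) (suc zero)
  b₂ R = R (suc (suc zero)) (suc (suc zero))
  a₂ R = R (suc (suc (suc zero))) (suc (suc (suc zero)))
  d₁ R = R zero (suc (suc (suc zero)))
  d₂ R = R (suc (suc (suc zero))) zero

  SixVertex : Mat4 → Set ℓ
  SixVertex R = ∀ i j → OffShape i j → R i j ≈ 0#
    where
    OffShape : Fin 4 → Fin 4 → Set
    OffShape zero zero = ⊥
    OffShape (suc zero) (suc zero) = ⊥
    OffShape (suc zero) (suc (suc zero)) = ⊥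
    OffShape (suc (suc zero)) (suc zero) = ⊥
    OffShape (suc (suc zero)) (suc (suc zero)) = ⊥
    OffShape (suc (suc (suc zero))) (suc (suc (suc zero))) = ⊥
    OffShape _ _ = ⊤

  -- basis index of v_i ⊗ v_j  (0 = +, 1 = −)
  pair : Fin 2 → Fin 2 → Fin 4
  pair zero zero = zero
  pair zero (suc zero) = suc zero
  pair (suc zero) zero = suc (suc zero)
  pair (suc zero) (suc zero) = suc (suc (suc zero))

  Idx3 : Set
  Idx3 = Fin 2 × Fin 2 × Fin 2

  Mat8 : Set c
  Mat8 = Idx3 → Idx3 → Carrier

  δ : Fin 2 → Fin 2 → Carrier
  δ zero zero = 1#
  δ (suc zero) (suc zero) = 1#
  δ zero (suc zero) = 0#
  δ (suc zero) zero = 0#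

  -- φ₁₂, φ₁₃, φ₂₃ (linear extension of φ'⊗φ'' ↦ φ'⊗φ''⊗1 etc.)
  _₁₂ _₁₃ _₂₃ : Mat4 → Mat8
  (φ ₁₂) (i , j , k) (i' , j' , k') = φ (pair i j) (pair i' j') * δ k k'
  (φ ₁₃) (i , j , k) (i' , j' , k') = φ (pair i k) (pair i' k') * δ j j'
  (φ ₂₃) (i , j , k) (i' , j' , k') = φ (pair j k) (pair j' k') * δ i i'

  sum2 : (Fin 2 → Carrier) → Carrier
  sum2 f = f zero + f (suc zero)

  sum8 : (Idx3 → Carrier) → Carrier
  sum8 f = sum2 λ i → sum2 λ j → sum2 λ k → f (i , j , k)

  _⊙_ : Mat8 → Mat8 → Mat8
  (A ⊙ B) x z = sum8 λ y → A x y * B y z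

  ⟦_,_,_⟧ : Mat4 → Mat4 → Mat4 → Mat8
  ⟦ φ , ψ , χ ⟧ x z = (((φ ₁₂) ⊙ (ψ ₁₃)) ⊙ (χ ₂₃)) x z - (((χ ₂₃) ⊙ (ψ ₁₃)) ⊙ (φ ₁₂)) x z

  IsZero8 : Mat8 → Set ℓ
  IsZero8 M = ∀ x z → M x z ≈ 0#

  △₁ △₂ : Mat4 → Carrier
  △₁ R = (a₁ R * a₂ R + b₁ R * b₂ R - c₁ R * c₂ R) / (2# * a₁ R * b₁ R)
  △₂ R = (a₁ R * a₂ R + b₁ R * b₂ R - c₁ R * c₂ R) / (2# * a₂ R * b₂ R)

-- For six-vertex R, S, T only fourteen entries of ⟦ R , S , T ⟧ can be nonzero; they amount to
-- thirteen equations, each linear in the weights of R.  Eliminating the weights of R (using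
-- c₁ R ≠ 0) leaves exactly △₁ S = △₁ T and △₂ S = △₂ T; conversely, when these hold the linear
-- system has an explicit solution with c₁ R, c₂ R ≠ 0.  Every polynomial identity is checked by
-- normalisation over natural-number coefficients: subtraction is avoided by moving terms across,
-- and an identity that needs hypotheses comes with the linear combination of them that proves it.
module Submission where

open import Defs
open import Level using (0ℓ; _⊔_)
open import Algebra.Bundles using (CommutativeRing; Semiring)
open import Algebra.Bundles.Raw using (RawSemiring)
import Algebra.Properties.Group as GroupProperties
open import Data.Fin using (Fin; zero; suc; #_)
open import Data.List using (List; []; _∷_; [_])
open import Data.Nat as ℕ using (ℕ)
open import Data.Product using (∃; _×_; _,_; proj₁; proj₂; uncurry; swap)
open import Data.Unit using (tt)
open import Data.Vec as Vec using (Vec; []; _∷_; _++_; lookup; tabulate; zipWith)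
open import Data.Vec.Properties using (lookup∘tabulate; lookup-map; ∷-injective)
open import Data.Vec.Relation.Unary.All using (All; []; _∷_)
open import Data.Vec.Relation.Unary.All.Properties using (lookup⁺)
open import Function.Bundles using (_⇔_; mk⇔; Equivalence)
open import Function.Properties.Equivalence using (⇔-setoid)
open import Relation.Binary.PropositionalEquality as ≡ using (_≡_)
import Relation.Binary.Reasoning.Setoid as SetoidReasoning

pattern ↑ = zero
pattern ↓ = suc zero

Triple : Set
Triple = Fin 2 × Fin 2 × Fin 2

tabulate³ : ∀ {a} {A : Set a} → (Triple → A) → Vec (Vec (Vec A 2) 2) 2
tabulate³ f = tabulate λ i → tabulate λ j → tabulate λ k → f (i , j , k)

lookup³ : ∀ {a} {A : Set a} → Vec (Vec (Vec A 2) 2) 2 → Triple → A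
lookup³ t (i , j , k) = lookup (lookup (lookup t i) j) k

lookup³∘tabulate³ : ∀ {a} {A : Set a} (f : Triple → A) x → lookup³ (tabulate³ f) x ≡ f x
lookup³∘tabulate³ f (i , j , k) = begin
  lookup (lookup (lookup (tabulate λ i → tabulate λ j → tabulate λ k → f (i , j , k)) i) j) k
    ≡⟨ ≡.cong (λ t → lookup (lookup t j) k) (lookup∘tabulate (λ i → tabulate λ j → tabulate λ k → f (i , j , k)) i) ⟩
  lookup (lookup (tabulate λ j → tabulate λ k → f (i , j , k)) j) k
    ≡⟨ ≡.cong (λ t → lookup t k) (lookup∘tabulate (λ j → tabulate λ k → f (i , j , k)) j) ⟩
  lookup (tabulate λ k → f (i , j , k)) k
    ≡⟨ lookup∘tabulate (λ k → f (i , j , k)) k ⟩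
  f (i , j , k)
    ∎
  where open ≡.≡-Reasoning

tabulate³-injective : ∀ {a} {A : Set a} (f g : Triple → A) →
                      tabulate³ f ≡ tabulate³ g → ∀ x → f x ≡ g x
tabulate³-injective f g eq x = begin
  f x                     ≡⟨ lookup³∘tabulate³ f x ⟨
  lookup³ (tabulate³ f) x ≡⟨ ≡.cong (λ t → lookup³ t x) eq ⟩
  lookup³ (tabulate³ g) x ≡⟨ lookup³∘tabulate³ g x ⟩
  g x                     ∎
  where open ≡.≡-Reasoning

tabulate³²-injective : ∀ {a} {A : Set a} (f g : Triple → Triple → A) →
                       tabulate³ (λ x → tabulate³ (f x)) ≡ tabulate³ (λ x → tabulate³ (g x)) →
                       ∀ x z → f x z ≡ g x z
tabulate³²-injective f g eq x =
  tabulate³-injective (f x) (g x) (tabulate³-injective (λ x → tabulate³ (f x)) (λ x → tabulate³ (g x)) eq x)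

-- Stated over any raw semiring, so that the same definitions give both the statements about
-- scalars and, over polynomials, the identities handed to the normaliser.
module SixVertex {c ℓ} (A : RawSemiring c ℓ) where
  open RawSemiring A

  Matrix : Set c
  Matrix = Fin 4 → Fin 4 → Carrier

  a₁ b₁ c₁ c₂ b₂ a₂ : Matrix → Carrier
  a₁ M = M zero zero
  b₁ M = M (suc zero) (suc zero)
  c₁ M = M (suc zero) (suc (suc zero))
  c₂ M = M (suc (suc zero)) (suc zero)
  b₂ M = M (suc (suc zero)) (suc (suc zero))
  a₂ M = M (suc (suc (suc zero))) (suc (suc (suc zero)))

  sixVertex : Carrier → Carrier → Carrier → Carrier → Carrier → Carrier → Matrix
  sixVertex α₁ β₁ γ₁ γ₂ β₂ α₂ zero zero = α₁
  sixVertex α₁ β₁ γ₁ γ₂ β₂ α₂ (suc zero) (suc zero) = β₁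
  sixVertex α₁ β₁ γ₁ γ₂ β₂ α₂ (suc zero) (suc (suc zero)) = γ₁
  sixVertex α₁ β₁ γ₁ γ₂ β₂ α₂ (suc (suc zero)) (suc zero) = γ₂
  sixVertex α₁ β₁ γ₁ γ₂ β₂ α₂ (suc (suc zero)) (suc (suc zero)) = β₂
  sixVertex α₁ β₁ γ₁ γ₂ β₂ α₂ (suc (suc (suc zero))) (suc (suc (suc zero))) = α₂
  sixVertex _ _ _ _ _ _ _ _ = 0#

  -- The entries of ⟦ R , S , T ⟧ that do not vanish identically for six-vertex R, S, T,
  -- each written as an equation between its positive and its negative part.  Comments refer
  -- to them as equations 1 to 13; in the code equation i is the index # (i − 1).
  yangBaxterSystem : Matrix → Matrix → Matrix → Vec (Carrier × Carrier) 13
  yangBaxterSystem R S T =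
      (a₁ R * b₁ S * c₁ T , b₁ R * a₁ S * c₁ T + c₂ R * c₁ S * b₁ T)
    ∷ (a₁ R * c₁ S * a₁ T , c₁ R * a₁ S * c₁ T + b₂ R * c₁ S * b₁ T)
    ∷ (a₁ R * b₁ S * c₂ T , b₁ R * a₁ S * c₂ T + c₁ R * c₂ S * b₁ T)
    ∷ (c₁ R * c₂ S * c₁ T , c₂ R * c₁ S * c₂ T)
    ∷ (c₁ R * b₂ S * a₁ T , c₁ R * a₁ S * b₂ T + b₂ R * c₁ S * c₂ T)
    ∷ (c₁ R * b₁ S * a₂ T , c₁ R * a₂ S * b₁ T + b₁ R * c₁ S * c₂ T)
    ∷ (a₂ R * c₁ S * a₂ T , c₁ R * a₂ S * c₁ T + b₁ R * c₁ S * b₂ T)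
    ∷ (a₁ R * c₂ S * a₁ T , b₂ R * c₂ S * b₁ T + c₂ R * a₁ S * c₂ T)
    ∷ (c₂ R * b₂ S * a₁ T , b₂ R * c₂ S * c₁ T + c₂ R * a₁ S * b₂ T)
    ∷ (c₂ R * b₁ S * a₂ T , b₁ R * c₂ S * c₁ T + c₂ R * a₂ S * b₁ T)
    ∷ (a₂ R * b₂ S * c₁ T , b₂ R * a₂ S * c₁ T + c₂ R * c₁ S * b₂ T)
    ∷ (a₂ R * c₂ S * a₂ T , b₁ R * c₂ S * b₂ T + c₂ R * a₂ S * c₂ T)
    ∷ (a₂ R * b₂ S * c₂ T , c₁ R * c₂ S * b₂ T + b₂ R * a₂ S * c₂ T)
    ∷ []

  numerator⁺ numerator⁻ : Matrix → Carrier
  numerator⁺ M = a₁ M * a₂ M + b₁ M * b₂ M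
  numerator⁻ M = c₁ M * c₂ M

  -- △ᵢ S = △ᵢ T with the denominators cleared and without subtraction.
  △₁-cleared △₂-cleared : Matrix → Matrix → Carrier × Carrier
  △₁-cleared S T = numerator⁺ S * (a₁ T * b₁ T) + numerator⁻ T * (a₁ S * b₁ S)
                 , numerator⁺ T * (a₁ S * b₁ S) + numerator⁻ S * (a₁ T * b₁ T)
  △₂-cleared S T = numerator⁺ S * (a₂ T * b₂ T) + numerator⁻ T * (a₂ S * b₂ S)
                 , numerator⁺ T * (a₂ S * b₂ S) + numerator⁻ S * (a₂ T * b₂ T)

  -- The c-weights are chosen to satisfy equation 4 of the system; equations 6, 5, 2 and 7
  -- then force b₁, b₂, a₁ and a₂, where β₁ and β₂ stand for the differences
  -- a₂ T b₁ S − a₂ S b₁ T and a₁ T b₂ S − a₁ S b₂ T.  The common factor a₁ T a₂ T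
  -- clears the denominators.
  solution : Matrix → Matrix → Carrier → Carrier → Matrix
  solution S T β₁ β₂ = sixVertex
    ((a₁ S * c₁ T * c₂ T + b₁ T * β₂) * a₂ T)
    (β₁ * (a₁ T * a₂ T))
    (c₁ S * c₂ T * (a₁ T * a₂ T))
    (c₂ S * c₁ T * (a₁ T * a₂ T))
    (β₂ * (a₁ T * a₂ T))
    ((a₂ S * c₁ T * c₂ T + b₂ T * β₁) * a₁ T)

module SixVertexYangBaxter {c ℓ} (K : ACF0 c ℓ) where
  open ACF0 K using (cring; inverse; char0)
  open CommutativeRing cring
    using ( setoid; refl; sym; trans; reflexive; +-cong; +-congˡ; +-congʳ; +-assoc
          ; *-cong; *-congˡ; *-congʳ; *-comm; *-identityˡ; *-identityʳ; +-identityʳ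
          ; zeroʳ; distribʳ; +-group; semiring; commutativeSemiring)
  open GroupProperties +-group using (∙-cancelʳ; //-rightDividesˡ; x∙y⁻¹≈ε⇒x≈y; x≈y⇒x∙y⁻¹≈ε)
  open Matrices K
  open import Algebra.Solver.Ring.NaturalCoefficients.Default commutativeSemiring
    renaming (⟦_⟧ to ⟦_⟧ₚ; ⟦_⟧↓ to ⟦_⟧ₚ↓)

  module Scalar = SixVertex (Semiring.rawSemiring semiring)

  private module ≈-Reasoning = SetoidReasoning setoid

  -- Field arithmetic

  inverse-cancelˡ : ∀ {k} → k ≉0 → ∀ x → k ⁻¹ * (k * x) ≈ x
  inverse-cancelˡ {k} k≉0 x = begin
    k ⁻¹ * (k * x)  ≈⟨ solve 3 (λ k k' x → k' :* (k :* x) := k :* k' :* x) refl k (k ⁻¹) x ⟩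
    k * k ⁻¹ * x    ≈⟨ *-congʳ (inverse k k≉0) ⟩
    1# * x          ≈⟨ *-identityˡ x ⟩
    x               ∎
    where open ≈-Reasoning

  ≉0-* : ∀ {x y} → x ≉0 → y ≉0 → (x * y) ≉0
  ≉0-* {x} {y} x≉0 y≉0 xy≈0 = y≉0 (begin
    y               ≈⟨ inverse-cancelˡ x≉0 y ⟨
    x ⁻¹ * (x * y)  ≈⟨ *-congˡ xy≈0 ⟩
    x ⁻¹ * 0#       ≈⟨ zeroʳ (x ⁻¹) ⟩
    0#              ∎)
    where open ≈-Reasoning

  *-cancelˡ-≉0 : ∀ {k x y} → k ≉0 → k * x ≈ k * y → x ≈ y
  *-cancelˡ-≉0 {k} {x} {y} k≉0 kx≈ky = begin
    x               ≈⟨ inverse-cancelˡ k≉0 x ⟨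
    k ⁻¹ * (k * x)  ≈⟨ *-congˡ kx≈ky ⟩
    k ⁻¹ * (k * y)  ≈⟨ inverse-cancelˡ k≉0 y ⟩
    y               ∎
    where open ≈-Reasoning

  2≉0 : 2# ≉0
  2≉0 2≈0 = char0 1 (trans (+-congˡ (+-identityʳ 1#)) 2≈0)

  *-/-cancel : ∀ {p} → p ≉0 → ∀ x q → x * q ≈ p * q * (x / p)
  *-/-cancel {p} p≉0 x q = begin
    x * q                 ≈⟨ *-identityʳ (x * q) ⟨
    x * q * 1#            ≈⟨ *-congˡ (inverse p p≉0) ⟨
    x * q * (p * p ⁻¹)    ≈⟨ solve 4 (λ x q p p' → x :* q :* (p :* p') := p :* q :* (x :* p'))
                                   refl x q p (p ⁻¹) ⟩
    p * q * (x / p)       ∎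
    where open ≈-Reasoning

  /-≈-⇔ : ∀ {x y p q} → p ≉0 → q ≉0 → (x / p ≈ y / q ⇔ x * q ≈ y * p)
  /-≈-⇔ {x} {y} {p} {q} p≉0 q≉0 = mk⇔
    (λ x/p≈y/q → begin
      x * q            ≈⟨ *-/-cancel p≉0 x q ⟩
      p * q * (x / p)  ≈⟨ *-cong (*-comm p q) x/p≈y/q ⟩
      q * p * (y / q)  ≈⟨ *-/-cancel q≉0 y p ⟨
      y * p            ∎)
    (λ xq≈yp → *-cancelˡ-≉0 (≉0-* p≉0 q≉0) (begin
      p * q * (x / p)  ≈⟨ *-/-cancel p≉0 x q ⟨
      x * q            ≈⟨ xq≈yp ⟩
      y * p            ≈⟨ *-/-cancel q≉0 y p ⟩
      q * p * (y / q)  ≈⟨ *-congʳ (*-comm q p) ⟩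
      p * q * (y / q)  ∎))
    where open ≈-Reasoning

  +-shift-⇔ : ∀ {a b p a' b' p'} → a + b ≈ p → a' + b' ≈ p' → (a ≈ a' ⇔ p + b' ≈ p' + b)
  +-shift-⇔ {a} {b} {p} {a'} {b'} {p'} a+b≈p a'+b'≈p' = mk⇔
    (λ a≈a' → begin
      p + b'        ≈⟨ +-congʳ a+b≈p ⟨
      a + b + b'    ≈⟨ +-congʳ (+-congʳ a≈a') ⟩
      a' + b + b'   ≈⟨ solve 3 (λ a' b b' → a' :+ b :+ b' := a' :+ b' :+ b) refl a' b b' ⟩
      a' + b' + b   ≈⟨ +-congʳ a'+b'≈p' ⟩
      p' + b        ∎)
    (λ p+b'≈p'+b → ∙-cancelʳ (b + b') a a' (begin
      a + (b + b')  ≈⟨ +-assoc a b b' ⟨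
      a + b + b'    ≈⟨ +-congʳ a+b≈p ⟩
      p + b'        ≈⟨ p+b'≈p'+b ⟩
      p' + b        ≈⟨ +-congʳ a'+b'≈p' ⟨
      a' + b' + b   ≈⟨ solve 3 (λ a' b b' → a' :+ b' :+ b := a' :+ (b :+ b')) refl a' b b' ⟩
      a' + (b + b') ∎))
    where open ≈-Reasoning

  -+-cancel : ∀ u w → u - w + w ≈ u
  -+-cancel u w = //-rightDividesˡ w u

  -[]*-cancel : ∀ u w k → (u - w) * k + w * k ≈ u * k
  -[]*-cancel u w k = begin
    (u - w) * k + w * k  ≈⟨ distribʳ k (u - w) w ⟨
    (u - w + w) * k      ≈⟨ *-congʳ (-+-cancel u w) ⟩
    u * k                ∎
    where open ≈-Reasoning

  ≈-resp-⇔ : ∀ {x x' y y'} → x ≈ x' → y ≈ y' → (x ≈ y ⇔ x' ≈ y')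
  ≈-resp-⇔ x≈x' y≈y' = mk⇔ (λ x≈y → trans (sym x≈x') (trans x≈y y≈y'))
                            (λ x'≈y' → trans x≈x' (trans x'≈y' (sym y≈y')))

  △-≈-⇔ : ∀ {u w a b u' w' a' b'} → a ≉0 → b ≉0 → a' ≉0 → b' ≉0 →
          ((u - w) / (2# * a * b) ≈ (u' - w') / (2# * a' * b')
            ⇔ u * (a' * b') + w' * (a * b) ≈ u' * (a * b) + w * (a' * b'))
  △-≈-⇔ {u} {w} {a} {b} {u'} {w'} {a'} {b'} a≉0 b≉0 a'≉0 b'≉0 = begin
    (u - w) / (2# * a * b) ≈ (u' - w') / (2# * a' * b')
      ≈⟨ /-≈-⇔ (≉0-* (≉0-* 2≉0 a≉0) b≉0) (≉0-* (≉0-* 2≉0 a'≉0) b'≉0) ⟩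
    (u - w) * (2# * a' * b') ≈ (u' - w') * (2# * a * b)
      ≈⟨ ≈-resp-⇔ (factor-2 (u - w) a' b') (factor-2 (u' - w') a b) ⟩
    2# * ((u - w) * (a' * b')) ≈ 2# * ((u' - w') * (a * b))
      ≈⟨ mk⇔ (*-cancelˡ-≉0 2≉0) *-congˡ ⟩
    (u - w) * (a' * b') ≈ (u' - w') * (a * b)
      ≈⟨ +-shift-⇔ (-[]*-cancel u w (a' * b')) (-[]*-cancel u' w' (a * b)) ⟩
    u * (a' * b') + w' * (a * b) ≈ u' * (a * b) + w * (a' * b')
      ∎
    where
    open SetoidReasoning (⇔-setoid ℓ)
    factor-2 : ∀ d a b → d * (2# * a * b) ≈ 2# * (d * (a * b))
    factor-2 d a b = solve 4 (λ d t a b → d :* (t :* a :* b) := t :* (d :* (a :* b))) refl d 2# a b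

  △₁-≈-⇔ : ∀ S T → a₁ S ≉0 → b₁ S ≉0 → a₁ T ≉0 → b₁ T ≉0 →
           (△₁ S ≈ △₁ T ⇔ uncurry _≈_ (Scalar.△₁-cleared S T))
  △₁-≈-⇔ S T = △-≈-⇔

  △₂-≈-⇔ : ∀ S T → a₂ S ≉0 → b₂ S ≉0 → a₂ T ≉0 → b₂ T ≉0 →
           (△₂ S ≈ △₂ T ⇔ uncurry _≈_ (Scalar.△₂-cleared S T))
  △₂-≈-⇔ S T = △-≈-⇔

  -- Polynomial identities under hypotheses

  Equation : ℕ → Set
  Equation n = Polynomial n × Polynomial n

  ⟦_⟧² ⟦_⟧↓² : ∀ {n} → Equation n → Env n → Carrier × Carrier
  ⟦ l , r ⟧² ρ = ⟦ l ⟧ₚ ρ , ⟦ r ⟧ₚ ρ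
  ⟦ l , r ⟧↓² ρ = ⟦ l ⟧ₚ↓ ρ , ⟦ r ⟧ₚ↓ ρ

  _⊨_ : ∀ {n k} → Env n → Vec (Equation n) k → Set (c ⊔ ℓ)
  ρ ⊨ es = All (uncurry _≈_) (Vec.map (λ e → ⟦ e ⟧² ρ) es)

  ⊨-map : ∀ {a n k} {A : Set a} {ρ : Env n} {f : A → Equation n} →
          (∀ x → uncurry _≈_ (⟦ f x ⟧² ρ)) → (xs : Vec A k) → ρ ⊨ Vec.map f xs
  ⊨-map holds []       = []
  ⊨-map holds (x ∷ xs) = holds x ∷ ⊨-map holds xs

  -- p ·⁺ i stands for p (lᵢ − rᵢ) and p ·⁻ i for p (rᵢ − lᵢ), where lᵢ = rᵢ is the i-th hypothesis.
  infix 6 _·⁺_ _·⁻_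
  data Summand (n k : ℕ) : Set where
    _·⁺_ _·⁻_ : Polynomial n → Fin k → Summand n k

  infixr 5 _⊕_
  infix 6 _⊛_
  _⊕_ : ∀ {n} → Equation n → Equation n → Equation n
  (l , r) ⊕ (l' , r') = l :+ l' , r :+ r'

  _⊛_ : ∀ {n} → Polynomial n → Equation n → Equation n
  p ⊛ (l , r) = p :* l , p :* r

  combination : ∀ {n k} → Vec (Equation n) k → List (Summand n k) → Equation n
  combination es []            = con 0 , con 0
  combination es (p ·⁺ i ∷ ss) = p ⊛ lookup es i ⊕ combination es ss
  combination es (p ·⁻ i ∷ ss) = p ⊛ swap (lookup es i) ⊕ combination es ss

  -- L − R = Σ ± pᵢ (lᵢ − rᵢ), with both sides moved so that no subtraction occurs.
  certified : ∀ {n k} → Vec (Equation n) k → Equation n → List (Summand n k) → Equation n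
  certified es e ss = e ⊕ swap (combination es ss)

  -- The normal-form identities of a whole batch of certificates, checked by a single ≡.refl.
  CertifiedBatch : ∀ {n k m} → Env n → Vec (Equation n) k →
                   Vec (Equation n) m → Vec (List (Summand n k)) m → Set c
  CertifiedBatch ρ es ts cs = Vec.map proj₁ normal-forms ≡ Vec.map proj₂ normal-forms
    where normal-forms = zipWith (λ t ss → ⟦ certified es t ss ⟧↓² ρ) ts cs

  module FromHypotheses {n k} (ρ : Env n) (es : Vec (Equation n) k) (hs : ρ ⊨ es) where

    hypothesis : ∀ i → uncurry _≈_ (⟦ lookup es i ⟧² ρ)
    hypothesis i = ≡.subst (uncurry _≈_) (lookup-map i (λ e → ⟦ e ⟧² ρ) es) (lookup⁺ hs i)

    combination-holds : ∀ ss → uncurry _≈_ (⟦ combination es ss ⟧² ρ)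
    combination-holds []            = refl
    combination-holds (p ·⁺ i ∷ ss) = +-cong (*-congˡ (hypothesis i)) (combination-holds ss)
    combination-holds (p ·⁻ i ∷ ss) = +-cong (*-congˡ (sym (hypothesis i))) (combination-holds ss)

    by-certificate : ∀ e ss → uncurry _≡_ (⟦ certified es e ss ⟧↓² ρ) → uncurry _≈_ (⟦ e ⟧² ρ)
    by-certificate (L , R) ss normal-forms = ∙-cancelʳ _ _ _ (begin
      ⟦ L ⟧ₚ ρ + ⟦ r ⟧ₚ ρ  ≈⟨ prove ρ (L :+ r) (R :+ l) (reflexive normal-forms) ⟩
      ⟦ R ⟧ₚ ρ + ⟦ l ⟧ₚ ρ  ≈⟨ +-congˡ (combination-holds ss) ⟩
      ⟦ R ⟧ₚ ρ + ⟦ r ⟧ₚ ρ  ∎)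
      where
      open ≈-Reasoning
      l = proj₁ (combination es ss)
      r = proj₂ (combination es ss)

    ⊨-by-certificates : ∀ {m} (ts : Vec (Equation n) m) (cs : Vec (List (Summand n k)) m) →
                        CertifiedBatch ρ es ts cs → ρ ⊨ ts
    ⊨-by-certificates []       []        _  = []
    ⊨-by-certificates (t ∷ ts) (ss ∷ cs) eq =
      by-certificate t ss (proj₁ (∷-injective eq)) ∷ ⊨-by-certificates ts cs (proj₂ (∷-injective eq))

  -- Matrices of polynomials

  rawSemiringₚ : ℕ → RawSemiring 0ℓ 0ℓ
  rawSemiringₚ n = record
    { Carrier = Polynomial n ; _≈_ = _≡_ ; _+_ = _:+_ ; _*_ = _:*_ ; 0# = con 0 ; 1# = con 1 }

  module Syntax {n} = SixVertex (rawSemiringₚ n)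
  open Syntax using (sixVertex; yangBaxterSystem; △₁-cleared; △₂-cleared; solution)

  Matrixₚ Matrix₈ₚ : ℕ → Set
  Matrixₚ n = Fin 4 → Fin 4 → Polynomial n
  Matrix₈ₚ n = Idx3 → Idx3 → Polynomial n

  δₚ : ∀ {n} → Fin 2 → Fin 2 → Polynomial n
  δₚ ↑ ↑ = con 1
  δₚ ↑ ↓ = con 0
  δₚ ↓ ↑ = con 0
  δₚ ↓ ↓ = con 1

  _₁₂ₚ _₁₃ₚ _₂₃ₚ : ∀ {n} → Matrixₚ n → Matrix₈ₚ n
  (φ ₁₂ₚ) (i , j , k) (i' , j' , k') = φ (pair i j) (pair i' j') :* δₚ k k'
  (φ ₁₃ₚ) (i , j , k) (i' , j' , k') = φ (pair i k) (pair i' k') :* δₚ j j'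
  (φ ₂₃ₚ) (i , j , k) (i' , j' , k') = φ (pair j k) (pair j' k') :* δₚ i i'

  sum2ₚ : ∀ {n} → (Fin 2 → Polynomial n) → Polynomial n
  sum2ₚ f = f ↑ :+ f ↓

  _⊙ₚ_ : ∀ {n} → Matrix₈ₚ n → Matrix₈ₚ n → Matrix₈ₚ n
  (A ⊙ₚ B) x z = sum2ₚ λ i → sum2ₚ λ j → sum2ₚ λ k → A x (i , j , k) :* B (i , j , k) z

  leftₚ rightₚ : ∀ {n} → Matrixₚ n → Matrixₚ n → Matrixₚ n → Matrix₈ₚ n
  leftₚ φ ψ χ = ((φ ₁₂ₚ) ⊙ₚ (ψ ₁₃ₚ)) ⊙ₚ (χ ₂₃ₚ)
  rightₚ φ ψ χ = ((χ ₂₃ₚ) ⊙ₚ (ψ ₁₃ₚ)) ⊙ₚ (φ ₁₂ₚ)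

  Evaluates : ∀ {n} → Env n → Matrixₚ n → Mat4 → Set ℓ
  Evaluates ρ A M = ∀ i j → ⟦ A i j ⟧ₚ ρ ≈ M i j

  Evaluates₈ : ∀ {n} → Env n → Matrix₈ₚ n → Mat8 → Set ℓ
  Evaluates₈ ρ A M = ∀ x z → ⟦ A x z ⟧ₚ ρ ≈ M x z

  module _ {n} {ρ : Env n} where

    ⟦δ⟧ : ∀ k k' → ⟦ δₚ k k' ⟧ₚ ρ ≡ δ k k'
    ⟦δ⟧ ↑ ↑ = ≡.refl
    ⟦δ⟧ ↑ ↓ = ≡.refl
    ⟦δ⟧ ↓ ↑ = ≡.refl
    ⟦δ⟧ ↓ ↓ = ≡.refl

    ⟦₁₂⟧ : ∀ {A M} → Evaluates ρ A M → Evaluates₈ ρ (A ₁₂ₚ) (M ₁₂)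
    ⟦₁₂⟧ h (i , j , k) (i' , j' , k') = *-cong (h (pair i j) (pair i' j')) (reflexive (⟦δ⟧ k k'))
    ⟦₁₃⟧ : ∀ {A M} → Evaluates ρ A M → Evaluates₈ ρ (A ₁₃ₚ) (M ₁₃)
    ⟦₁₃⟧ h (i , j , k) (i' , j' , k') = *-cong (h (pair i k) (pair i' k')) (reflexive (⟦δ⟧ j j'))
    ⟦₂₃⟧ : ∀ {A M} → Evaluates ρ A M → Evaluates₈ ρ (A ₂₃ₚ) (M ₂₃)
    ⟦₂₃⟧ h (i , j , k) (i' , j' , k') = *-cong (h (pair j k) (pair j' k')) (reflexive (⟦δ⟧ i i'))

    sum2-cong : ∀ {f g : Fin 2 → Carrier} → (∀ i → f i ≈ g i) → sum2 f ≈ sum2 g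
    sum2-cong f≈g = +-cong (f≈g ↑) (f≈g ↓)

    sum8-cong : ∀ {f g : Idx3 → Carrier} → (∀ y → f y ≈ g y) → sum8 f ≈ sum8 g
    sum8-cong f≈g = sum2-cong λ i → sum2-cong λ j → sum2-cong λ k → f≈g (i , j , k)

    ⟦⊙⟧ : ∀ {A B M N} → Evaluates₈ ρ A M → Evaluates₈ ρ B N → Evaluates₈ ρ (A ⊙ₚ B) (M ⊙ N)
    ⟦⊙⟧ hA hB x z = sum8-cong λ y → *-cong (hA x y) (hB y z)

    ⟦left⟧ : ∀ {A B C R S T} → Evaluates ρ A R → Evaluates ρ B S → Evaluates ρ C T →
             Evaluates₈ ρ (leftₚ A B C) (((R ₁₂) ⊙ (S ₁₃)) ⊙ (T ₂₃))
    ⟦left⟧ {A} {B} {C} hA hB hC =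
      ⟦⊙⟧ {(A ₁₂ₚ) ⊙ₚ (B ₁₃ₚ)} {C ₂₃ₚ} (⟦⊙⟧ {A ₁₂ₚ} {B ₁₃ₚ} (⟦₁₂⟧ {A} hA) (⟦₁₃⟧ {B} hB)) (⟦₂₃⟧ {C} hC)

    ⟦right⟧ : ∀ {A B C R S T} → Evaluates ρ A R → Evaluates ρ B S → Evaluates ρ C T →
              Evaluates₈ ρ (rightₚ A B C) (((T ₂₃) ⊙ (S ₁₃)) ⊙ (R ₁₂))
    ⟦right⟧ {A} {B} {C} hA hB hC =
      ⟦⊙⟧ {(C ₂₃ₚ) ⊙ₚ (B ₁₃ₚ)} {A ₁₂ₚ} (⟦⊙⟧ {C ₂₃ₚ} {B ₁₃ₚ} (⟦₂₃⟧ {C} hC) (⟦₁₃⟧ {B} hB)) (⟦₁₂⟧ {A} hA)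

    sixVertex-evaluates : ∀ {M p₁ p₂ p₃ p₄ p₅ p₆} → SixVertex M →
      ⟦ p₁ ⟧ₚ ρ ≈ a₁ M → ⟦ p₂ ⟧ₚ ρ ≈ b₁ M → ⟦ p₃ ⟧ₚ ρ ≈ c₁ M →
      ⟦ p₄ ⟧ₚ ρ ≈ c₂ M → ⟦ p₅ ⟧ₚ ρ ≈ b₂ M → ⟦ p₆ ⟧ₚ ρ ≈ a₂ M →
      Evaluates ρ (sixVertex p₁ p₂ p₃ p₄ p₅ p₆) M
    sixVertex-evaluates _ e₁ _ _ _ _ _ zero zero = e₁
    sixVertex-evaluates sv _ _ _ _ _ _ zero (suc zero) = sym (sv _ _ tt)
    sixVertex-evaluates sv _ _ _ _ _ _ zero (suc (suc zero)) = sym (sv _ _ tt)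
    sixVertex-evaluates sv _ _ _ _ _ _ zero (suc (suc (suc zero))) = sym (sv _ _ tt)
    sixVertex-evaluates sv _ _ _ _ _ _ (suc zero) zero = sym (sv _ _ tt)
    sixVertex-evaluates _ _ e₂ _ _ _ _ (suc zero) (suc zero) = e₂
    sixVertex-evaluates _ _ _ e₃ _ _ _ (suc zero) (suc (suc zero)) = e₃
    sixVertex-evaluates sv _ _ _ _ _ _ (suc zero) (suc (suc (suc zero))) = sym (sv _ _ tt)
    sixVertex-evaluates sv _ _ _ _ _ _ (suc (suc zero)) zero = sym (sv _ _ tt)
    sixVertex-evaluates _ _ _ _ e₄ _ _ (suc (suc zero)) (suc zero) = e₄
    sixVertex-evaluates _ _ _ _ _ e₅ _ (suc (suc zero)) (suc (suc zero)) = e₅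
    sixVertex-evaluates sv _ _ _ _ _ _ (suc (suc zero)) (suc (suc (suc zero))) = sym (sv _ _ tt)
    sixVertex-evaluates sv _ _ _ _ _ _ (suc (suc (suc zero))) zero = sym (sv _ _ tt)
    sixVertex-evaluates sv _ _ _ _ _ _ (suc (suc (suc zero))) (suc zero) = sym (sv _ _ tt)
    sixVertex-evaluates sv _ _ _ _ _ _ (suc (suc (suc zero))) (suc (suc zero)) = sym (sv _ _ tt)
    sixVertex-evaluates _ _ _ _ _ _ e₆ (suc (suc (suc zero))) (suc (suc (suc zero))) = e₆

  sixVertex-isSixVertex : ∀ {α₁ β₁ γ₁ γ₂ β₂ α₂} → SixVertex (Scalar.sixVertex α₁ β₁ γ₁ γ₂ β₂ α₂)
  sixVertex-isSixVertex zero zero ()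
  sixVertex-isSixVertex zero (suc zero) _ = refl
  sixVertex-isSixVertex zero (suc (suc zero)) _ = refl
  sixVertex-isSixVertex zero (suc (suc (suc zero))) _ = refl
  sixVertex-isSixVertex (suc zero) zero _ = refl
  sixVertex-isSixVertex (suc zero) (suc zero) ()
  sixVertex-isSixVertex (suc zero) (suc (suc zero)) ()
  sixVertex-isSixVertex (suc zero) (suc (suc (suc zero))) _ = refl
  sixVertex-isSixVertex (suc (suc zero)) zero _ = refl
  sixVertex-isSixVertex (suc (suc zero)) (suc zero) ()
  sixVertex-isSixVertex (suc (suc zero)) (suc (suc zero)) ()
  sixVertex-isSixVertex (suc (suc zero)) (suc (suc (suc zero))) _ = refl
  sixVertex-isSixVertex (suc (suc (suc zero))) zero _ = refl
  sixVertex-isSixVertex (suc (suc (suc zero))) (suc zero) _ = refl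
  sixVertex-isSixVertex (suc (suc (suc zero))) (suc (suc zero)) _ = refl
  sixVertex-isSixVertex (suc (suc (suc zero))) (suc (suc (suc zero))) ()

  -- The Yang–Baxter system

  YangBaxterSystem : Mat4 → Mat4 → Mat4 → Set (c ⊔ ℓ)
  YangBaxterSystem R S T = All (uncurry _≈_) (Scalar.yangBaxterSystem R S T)

  weights : Mat4 → Vec Carrier 6
  weights M = a₁ M ∷ b₁ M ∷ c₁ M ∷ c₂ M ∷ b₂ M ∷ a₂ M ∷ []

  -- The weights of S and T are the first twelve variables of every environment below.
  a₁ˢ b₁ˢ c₁ˢ c₂ˢ b₂ˢ a₂ˢ a₁ᵀ b₁ᵀ c₁ᵀ c₂ᵀ b₂ᵀ a₂ᵀ : ∀ {m} → Polynomial (12 ℕ.+ m)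
  a₁ˢ = var (# 0)
  b₁ˢ = var (# 1)
  c₁ˢ = var (# 2)
  c₂ˢ = var (# 3)
  b₂ˢ = var (# 4)
  a₂ˢ = var (# 5)
  a₁ᵀ = var (# 6)
  b₁ᵀ = var (# 7)
  c₁ᵀ = var (# 8)
  c₂ᵀ = var (# 9)
  b₂ᵀ = var (# 10)
  a₂ᵀ = var (# 11)

  Sₚ Tₚ : ∀ {m} → Matrixₚ (12 ℕ.+ m)
  Sₚ = sixVertex a₁ˢ b₁ˢ c₁ˢ c₂ˢ b₂ˢ a₂ˢ
  Tₚ = sixVertex a₁ᵀ b₁ᵀ c₁ᵀ c₂ᵀ b₂ᵀ a₂ᵀ

  module Commutator (R S T : Mat4) where

    ρ : Env 18
    ρ = weights S ++ weights T ++ weights R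

    a₁ᴿ b₁ᴿ c₁ᴿ c₂ᴿ b₂ᴿ a₂ᴿ : Polynomial 18
    a₁ᴿ = var (# 12)
    b₁ᴿ = var (# 13)
    c₁ᴿ = var (# 14)
    c₂ᴿ = var (# 15)
    b₂ᴿ = var (# 16)
    a₂ᴿ = var (# 17)

    Rₚ : Matrixₚ 18
    Rₚ = sixVertex a₁ᴿ b₁ᴿ c₁ᴿ c₂ᴿ b₂ᴿ a₂ᴿ

    systemₚ : Vec (Equation 18) 13
    systemₚ = yangBaxterSystem Rₚ Sₚ Tₚ

    entry : Idx3 → Idx3 → Equation 18
    entry x z = leftₚ Rₚ Sₚ Tₚ x z , rightₚ Rₚ Sₚ Tₚ x z

    -- The equation of the system that each entry of the commutator is, up to sign; the entries
    -- not listed vanish identically.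
    entryCertificate : Idx3 → Idx3 → List (Summand 18 13)
    entryCertificate (↑ , ↑ , ↓) (↑ , ↓ , ↑) = [ con 1 ·⁺ # 0 ]
    entryCertificate (↑ , ↑ , ↓) (↓ , ↑ , ↑) = [ con 1 ·⁺ # 1 ]
    entryCertificate (↑ , ↓ , ↑) (↑ , ↑ , ↓) = [ con 1 ·⁻ # 2 ]
    entryCertificate (↑ , ↓ , ↑) (↑ , ↓ , ↑) = [ con 1 ·⁺ # 3 ]
    entryCertificate (↑ , ↓ , ↑) (↓ , ↑ , ↑) = [ con 1 ·⁺ # 4 ]
    entryCertificate (↑ , ↓ , ↓) (↓ , ↑ , ↓) = [ con 1 ·⁻ # 5 ]
    entryCertificate (↑ , ↓ , ↓) (↓ , ↓ , ↑) = [ con 1 ·⁻ # 6 ]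
    entryCertificate (↓ , ↑ , ↑) (↑ , ↑ , ↓) = [ con 1 ·⁻ # 7 ]
    entryCertificate (↓ , ↑ , ↑) (↑ , ↓ , ↑) = [ con 1 ·⁻ # 8 ]
    entryCertificate (↓ , ↑ , ↓) (↑ , ↓ , ↓) = [ con 1 ·⁺ # 9 ]
    entryCertificate (↓ , ↑ , ↓) (↓ , ↑ , ↓) = [ con 1 ·⁻ # 3 ]
    entryCertificate (↓ , ↑ , ↓) (↓ , ↓ , ↑) = [ con 1 ·⁻ # 10 ]
    entryCertificate (↓ , ↓ , ↑) (↑ , ↓ , ↓) = [ con 1 ·⁺ # 11 ]
    entryCertificate (↓ , ↓ , ↑) (↓ , ↑ , ↓) = [ con 1 ·⁺ # 12 ]
    entryCertificate _ _ = []

    -- For each equation of the system, an entry of the commutator that it is read off from.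
    systemEntries : Vec (Idx3 × Idx3) 13
    systemEntries =
        ((↑ , ↑ , ↓) , (↑ , ↓ , ↑)) ∷ ((↑ , ↑ , ↓) , (↓ , ↑ , ↑)) ∷ ((↑ , ↓ , ↑) , (↑ , ↑ , ↓))
      ∷ ((↑ , ↓ , ↑) , (↑ , ↓ , ↑)) ∷ ((↑ , ↓ , ↑) , (↓ , ↑ , ↑)) ∷ ((↑ , ↓ , ↓) , (↓ , ↑ , ↓))
      ∷ ((↑ , ↓ , ↓) , (↓ , ↓ , ↑)) ∷ ((↓ , ↑ , ↑) , (↑ , ↑ , ↓)) ∷ ((↓ , ↑ , ↑) , (↑ , ↓ , ↑))
      ∷ ((↓ , ↑ , ↓) , (↑ , ↓ , ↓)) ∷ ((↓ , ↑ , ↓) , (↓ , ↓ , ↑)) ∷ ((↓ , ↓ , ↑) , (↑ , ↓ , ↓))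
      ∷ ((↓ , ↓ , ↑) , (↓ , ↑ , ↓)) ∷ []

    normal-forms : Idx3 → Idx3 → Carrier × Carrier
    normal-forms x z = ⟦ certified systemₚ (entry x z) (entryCertificate x z) ⟧↓² ρ

    -- All 64 entries are checked at once by comparing two tables.
    entries-certified : ∀ x z → uncurry _≡_ (normal-forms x z)
    entries-certified = tabulate³²-injective (λ x z → proj₁ (normal-forms x z))
                                             (λ x z → proj₂ (normal-forms x z)) ≡.refl

    module _ (svR : SixVertex R) (svS : SixVertex S) (svT : SixVertex T) where

      entry-vanishes-⇔ : ∀ x z → (⟦ R , S , T ⟧ x z ≈ 0# ⇔ uncurry _≈_ (⟦ entry x z ⟧² ρ))
      entry-vanishes-⇔ x z = begin
        ⟦ R , S , T ⟧ x z ≈ 0#      ≈⟨ mk⇔ (x∙y⁻¹≈ε⇒x≈y _ _) x≈y⇒x∙y⁻¹≈ε ⟩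
        left x z ≈ right x z         ≈⟨ ≈-resp-⇔ (sym (⟦left⟧ {A = Rₚ} {Sₚ} {Tₚ} ⟦Rₚ⟧ ⟦Sₚ⟧ ⟦Tₚ⟧ x z))
                                                 (sym (⟦right⟧ {A = Rₚ} {Sₚ} {Tₚ} ⟦Rₚ⟧ ⟦Sₚ⟧ ⟦Tₚ⟧ x z)) ⟩
        uncurry _≈_ (⟦ entry x z ⟧² ρ) ∎
        where
        open SetoidReasoning (⇔-setoid ℓ)
        left right : Mat8
        left = ((R ₁₂) ⊙ (S ₁₃)) ⊙ (T ₂₃)
        right = ((T ₂₃) ⊙ (S ₁₃)) ⊙ (R ₁₂)
        ⟦Rₚ⟧ : Evaluates ρ Rₚ R
        ⟦Rₚ⟧ = sixVertex-evaluates {ρ = ρ} svR refl refl refl refl refl refl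
        ⟦Sₚ⟧ : Evaluates ρ Sₚ S
        ⟦Sₚ⟧ = sixVertex-evaluates {ρ = ρ} svS refl refl refl refl refl refl
        ⟦Tₚ⟧ : Evaluates ρ Tₚ T
        ⟦Tₚ⟧ = sixVertex-evaluates {ρ = ρ} svT refl refl refl refl refl refl

      -- Entry i of systemEntries is equation i up to sign ε, so its certificate [ ε · # i ] also
      -- derives equation i from that entry.
      yangBaxter⇔system : IsZero8 ⟦ R , S , T ⟧ ⇔ YangBaxterSystem R S T
      yangBaxter⇔system = mk⇔
        (λ vanishes → FromHypotheses.⊨-by-certificates ρ (Vec.map (uncurry entry) systemEntries)
          (⊨-map {ρ = ρ} {uncurry entry} (λ (x , z) → Equivalence.to (entry-vanishes-⇔ x z) (vanishes x z)) systemEntries)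
          systemₚ (Vec.map (uncurry entryCertificate) systemEntries) ≡.refl)
        (λ system x z → Equivalence.from (entry-vanishes-⇔ x z)
          (FromHypotheses.by-certificate ρ systemₚ system (entry x z) (entryCertificate x z) (entries-certified x z)))

    -- Equations 2 and 1 express a₁ R through c₁ R once b₂ R, b₁ R and c₂ R are eliminated
    -- with equations 5, 6 and 4; the two expressions agree exactly when △₁ S = △₁ T.
    system⇒△₁-cleared : YangBaxterSystem R S T → c₁ R ≉0 → c₁ T ≉0 →
                        uncurry _≈_ (Scalar.△₁-cleared S T)
    system⇒△₁-cleared system c₁R≉0 c₁T≉0 = *-cancelˡ-≉0 (≉0-* c₁R≉0 c₁T≉0)
      (FromHypotheses.by-certificate ρ systemₚ system (c₁ᴿ :* c₁ᵀ ⊛ △₁-cleared Sₚ Tₚ)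
        ( a₁ᵀ :* c₁ˢ :* c₂ᵀ ·⁺ # 0 ∷ b₁ˢ :* c₁ᵀ :* c₂ᵀ ·⁻ # 1 ∷ a₁ᵀ :* b₁ᵀ :* c₁ˢ ·⁻ # 3
        ∷ b₁ˢ :* b₁ᵀ :* c₁ᵀ ·⁺ # 4 ∷ a₁ˢ :* a₁ᵀ :* c₁ᵀ ·⁻ # 5 ∷ [])
        ≡.refl)

    -- Likewise for a₂ R, through equations 7 and 13.
    system⇒△₂-cleared : YangBaxterSystem R S T → c₁ R ≉0 → uncurry _≈_ (Scalar.△₂-cleared S T)
    system⇒△₂-cleared system c₁R≉0 = *-cancelˡ-≉0 c₁R≉0
      (FromHypotheses.by-certificate ρ systemₚ system (c₁ᴿ ⊛ △₂-cleared Sₚ Tₚ)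
        ( a₂ˢ :* a₂ᵀ ·⁻ # 4 ∷ b₂ˢ :* b₂ᵀ ·⁺ # 5 ∷ b₂ˢ :* c₂ᵀ ·⁻ # 6 ∷ a₂ᵀ :* c₁ˢ ·⁺ # 12 ∷ [])
        ≡.refl)

  module Solution (S T : Mat4) (β₁ β₂ : Carrier) where

    ρ : Env 14
    ρ = weights S ++ weights T ++ β₁ ∷ β₂ ∷ []

    β₁ₚ β₂ₚ : Polynomial 14
    β₁ₚ = var (# 12)
    β₂ₚ = var (# 13)

    hypothesesₚ : Vec (Equation 14) 4
    hypothesesₚ = (β₁ₚ :+ a₂ˢ :* b₁ᵀ , a₂ᵀ :* b₁ˢ) ∷ (β₂ₚ :+ a₁ˢ :* b₂ᵀ , a₁ᵀ :* b₂ˢ)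
                ∷ △₁-cleared Sₚ Tₚ ∷ △₂-cleared Sₚ Tₚ ∷ []

    -- Equations 2, 4, 7, 8 and 12 hold identically, 5, 6, 9 and 10 are the definitions of
    -- β₁ and β₂, and 1, 3, 11 and 13 reduce to △₁ S = △₁ T resp. △₂ S = △₂ T.
    certificates : Vec (List (Summand 14 4)) 13
    certificates =
        (a₁ˢ :* a₁ᵀ :* a₂ᵀ :* c₁ᵀ ·⁻ # 0 ∷ a₂ᵀ :* b₁ˢ :* b₁ᵀ :* c₁ᵀ ·⁺ # 1 ∷ a₂ᵀ :* c₁ᵀ ·⁺ # 2 ∷ [])
      ∷ []
      ∷ (a₁ˢ :* a₁ᵀ :* a₂ᵀ :* c₂ᵀ ·⁻ # 0 ∷ a₂ᵀ :* b₁ˢ :* b₁ᵀ :* c₂ᵀ ·⁺ # 1 ∷ a₂ᵀ :* c₂ᵀ ·⁺ # 2 ∷ [])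
      ∷ []
      ∷ [ a₁ᵀ :* a₂ᵀ :* c₁ˢ :* c₂ᵀ ·⁻ # 1 ]
      ∷ [ a₁ᵀ :* a₂ᵀ :* c₁ˢ :* c₂ᵀ ·⁻ # 0 ]
      ∷ []
      ∷ []
      ∷ [ a₁ᵀ :* a₂ᵀ :* c₁ᵀ :* c₂ˢ ·⁻ # 1 ]
      ∷ [ a₁ᵀ :* a₂ᵀ :* c₁ᵀ :* c₂ˢ ·⁻ # 0 ]
      ∷ (a₁ᵀ :* b₂ˢ :* b₂ᵀ :* c₁ᵀ ·⁺ # 0 ∷ a₁ᵀ :* a₂ˢ :* a₂ᵀ :* c₁ᵀ ·⁻ # 1 ∷ a₁ᵀ :* c₁ᵀ ·⁺ # 3 ∷ [])
      ∷ []
      ∷ (a₁ᵀ :* b₂ˢ :* b₂ᵀ :* c₂ᵀ ·⁺ # 0 ∷ a₁ᵀ :* a₂ˢ :* a₂ᵀ :* c₂ᵀ ·⁻ # 1 ∷ a₁ᵀ :* c₂ᵀ ·⁺ # 3 ∷ [])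
      ∷ []

    solution-satisfies-system :
      β₁ + a₂ S * b₁ T ≈ a₂ T * b₁ S → β₂ + a₁ S * b₂ T ≈ a₁ T * b₂ S →
      uncurry _≈_ (Scalar.△₁-cleared S T) → uncurry _≈_ (Scalar.△₂-cleared S T) →
      YangBaxterSystem (Scalar.solution S T β₁ β₂) S T
    solution-satisfies-system β₁-def β₂-def △₁≈ △₂≈ =
      FromHypotheses.⊨-by-certificates ρ hypothesesₚ (β₁-def ∷ β₂-def ∷ △₁≈ ∷ △₂≈ ∷ [])
        (yangBaxterSystem (solution Sₚ Tₚ β₁ₚ β₂ₚ) Sₚ Tₚ) certificates ≡.refl

theorem1 : ∀ {c ℓ} (K : ACF0 c ℓ) → let open Matrices K in
    (S T : Mat4) → SixVertex S → SixVertex T →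
    a₁ S ≉0 → a₂ S ≉0 → b₁ S ≉0 → b₂ S ≉0 → c₁ S ≉0 → c₂ S ≉0 →
    a₁ T ≉0 → a₂ T ≉0 → b₁ T ≉0 → b₂ T ≉0 → c₁ T ≉0 → c₂ T ≉0 →
    (∃ λ (R : Mat4) → SixVertex R × c₁ R ≉0 × c₂ R ≉0 × IsZero8 ⟦ R , S , T ⟧)
    ⇔ (△₁ S ≈ △₁ T × △₂ S ≈ △₂ T)
theorem1 K S T svS svT a₁S≉0 a₂S≉0 b₁S≉0 b₂S≉0 c₁S≉0 c₂S≉0 a₁T≉0 a₂T≉0 b₁T≉0 b₂T≉0 c₁T≉0 c₂T≉0 =
  mk⇔
    (λ (R , svR , c₁R≉0 , _ , vanishes) →
      let open Commutator R S T
          system = Equivalence.to (yangBaxter⇔system svR svS svT) vanishes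
      in Equivalence.from (△₁-≈-⇔ S T a₁S≉0 b₁S≉0 a₁T≉0 b₁T≉0) (system⇒△₁-cleared system c₁R≉0 c₁T≉0)
       , Equivalence.from (△₂-≈-⇔ S T a₂S≉0 b₂S≉0 a₂T≉0 b₂T≉0) (system⇒△₂-cleared system c₁R≉0))
    (λ (△₁≈ , △₂≈) →
        R₀ , sixVertex-isSixVertex
      , ≉0-* (≉0-* c₁S≉0 c₂T≉0) (≉0-* a₁T≉0 a₂T≉0)
      , ≉0-* (≉0-* c₂S≉0 c₁T≉0) (≉0-* a₁T≉0 a₂T≉0)
      , Equivalence.from (Commutator.yangBaxter⇔system R₀ S T sixVertex-isSixVertex svS svT)
          (Solution.solution-satisfies-system S T β₁ β₂ (-+-cancel _ _) (-+-cancel _ _)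
            (Equivalence.to (△₁-≈-⇔ S T a₁S≉0 b₁S≉0 a₁T≉0 b₁T≉0) △₁≈)
            (Equivalence.to (△₂-≈-⇔ S T a₂S≉0 b₂S≉0 a₂T≉0 b₂T≉0) △₂≈)))
  where
  open Matrices K
  open SixVertexYangBaxter K
  β₁ β₂ : Carrier
  β₁ = a₂ T * b₁ S - a₂ S * b₁ T
  β₂ = a₁ T * b₂ S - a₁ S * b₂ T
  R₀ : Mat4
  R₀ = Scalar.solution S T β₁ β₂
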